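{- Let $n \geq 4$ and let $G = CS_{3,n-3}$ be the cycle-star graph with cycle length $k=3$ and $n-k \geq 1$ pendant vertices. Then $es(G) = n-1$.
   Context: For integers $k \geq 3$ and $n > k$, the cycle-star graph $CS_{k,n-k}$ is the simple graph on $n$ vertices consisting of a cycle of length $k$ together with $n-k$ additional vertices of degree one (leaves), all adjacent to the same single vertex of the cycle. For a simple graph $G$, a vertex $k$-labeling is a map $\phi: V(G) \to \{1,2,\ldots,k\}$; the weight of an edge $uv$ is $w_\phi(uv) = \phi(u)+\phi(v)$. The labeling is an edge irregular $k$-labeling if distinct edges have distinct weights. The edge irregularity strength $es(G)$ is the minimum $k$ for which $G$ admits an edge irregular $k$-labeling. -}

module Defs where

open import Data.Nat using (ℕ; zero; suc; _+_; _≤_; _<_)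
open import Data.Fin using (Fin; toℕ)
open import Data.Product using (_×_; ∃)
open import Data.Sum using (_⊎_)
open import Relation.Binary.PropositionalEquality using (_≡_)
open import Relation.Nullary using (¬_)

-- A (simple) graph on vertex set Fin n, given by its adjacency relation.
-- (The cycle-star graphs below are symmetric by construction and loopless for k ≥ 3.)
Graph : ℕ → Set₁
Graph n = Fin n → Fin n → Set

-- Cycle-star graph CS_{k,m} on Fin (k + m):
-- vertices 0..k-1 form the cycle 0-1-...-(k-1)-0,
-- vertices k..k+m-1 are leaves adjacent to vertex 0.
data CSArc (k : ℕ) : ℕ → ℕ → Set where
  path  : ∀ {i} → suc i < k → CSArc k i (suc i)
  close : ∀ {j} → suc j ≡ k → CSArc k 0 j
  leaf  : ∀ {j} → k ≤ j → CSArc k 0 j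

CSAdj : (k m : ℕ) → Fin (k + m) → Fin (k + m) → Set
CSAdj k m u v = CSArc k (toℕ u) (toℕ v) ⊎ CSArc k (toℕ v) (toℕ u)

CS : (k m : ℕ) → Graph (k + m)
CS k m = CSAdj k m

record Labeling {n : ℕ} (k : ℕ) : Set where
  field
    φ     : Fin n → ℕ
    range : ∀ v → 1 ≤ φ v × φ v ≤ k

EdgeIrregular : ∀ {n} → Graph n → (k : ℕ) → Labeling {n} k → Set
EdgeIrregular {n} G k L =
  ∀ u v x y → G u v → G x y → φ u + φ v ≡ φ x + φ y →
    (u ≡ x × v ≡ y) ⊎ (u ≡ y × v ≡ x)
  where open Labeling L

HasEdgeIrregularLabeling : ∀ {n} → Graph n → ℕ → Set
HasEdgeIrregularLabeling G k = ∃ λ (L : Labeling k) → EdgeIrregular G k L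

EdgeIrregularityStrength : ∀ {n} → Graph n → ℕ → Set
EdgeIrregularityStrength G s =
  HasEdgeIrregularLabeling G s × (∀ k → HasEdgeIrregularLabeling G k → s ≤ k)

-- A vertex joined to d distinct neighbours forces d distinct labels on them, since the d edges
-- at it must get distinct weights; the hub of CS₃,ₘ has degree n − 1, so es ≥ n − 1.
-- Conversely, label every vertex v ≥ 1 by v and the hub by n − 1: the edges at the hub get the
-- distinct weights n, …, 2n − 2, and the remaining edge 1–2 gets weight 3 < n.
module Submission where

open import Defs
open import Data.Nat using (ℕ; _≤_; _∸_; zero; suc; _+_; _<_; z≤n; s≤s)
open import Data.Nat.Properties using (+-comm; +-cancelˡ-≡; +-mono-≤; ≤-refl; <⇒≢; ∸-cancelʳ-≡)
open import Data.Fin using (Fin; toℕ; fromℕ<) renaming (zero to fzero; suc to fsuc)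
open import Data.Fin.Properties
  using (toℕ-injective; fromℕ<-injective; injective⇒≤; toℕ<n; suc-injective)
open import Data.Product using (_×_; _,_; proj₁; swap)
open import Data.Sum as Sum using (_⊎_; inj₁; inj₂)
open import Data.Empty using (⊥-elim)
open import Function.Definitions using (Injective)
open import Relation.Binary.PropositionalEquality using (_≡_; refl; sym; trans; cong)

neighbourCount≤strength : ∀ {n d k} (G : Graph n) (u : Fin n) (nbr : Fin d → Fin n) →
                          Injective _≡_ _≡_ nbr → (∀ i → G u (nbr i)) →
                          HasEdgeIrregularLabeling G k → d ≤ k
neighbourCount≤strength {d = d} {k = k} G u nbr nbr-injective adjacent (L , irregular) =
  injective⇒≤ index-injective
  where
  open Labeling L

  label∸1<k : ∀ v → φ v ∸ 1 < k
  label∸1<k v with φ v | range v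
  ... | suc a | _ , a<k = a<k

  index : Fin d → Fin k
  index i = fromℕ< (label∸1<k (nbr i))

  index-injective : Injective _≡_ _≡_ index
  index-injective {i} {j} eq
    with irregular u (nbr i) u (nbr j) (adjacent i) (adjacent j) (cong (φ u +_) same-label)
    where
    same-label : φ (nbr i) ≡ φ (nbr j)
    same-label = ∸-cancelʳ-≡ (proj₁ (range (nbr i))) (proj₁ (range (nbr j)))
                   (fromℕ<-injective _ _ (label∸1<k (nbr i)) (label∸1<k (nbr j)) eq)
  ... | inj₁ (_ , i≡j)   = nbr-injective i≡j
  ... | inj₂ (u≡j , i≡u) = nbr-injective (trans i≡u u≡j)

ArcWeightInjective : (ℕ → ℕ → Set) → (ℕ → ℕ) → Set
ArcWeightInjective R f = ∀ {a b c d} → R a b → R c d → f a + f b ≡ f c + f d → a ≡ c × b ≡ d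

symmetricWeight-injective : ∀ {R : ℕ → ℕ → Set} {f : ℕ → ℕ} → ArcWeightInjective R f →
                            ∀ {a b c d} → R a b ⊎ R b a → R c d ⊎ R d c →
                            f a + f b ≡ f c + f d → (a ≡ c × b ≡ d) ⊎ (a ≡ d × b ≡ c)
symmetricWeight-injective inj (inj₁ r) (inj₁ s) eq = inj₁ (inj r s eq)
symmetricWeight-injective {f = f} inj {c = c} {d} (inj₁ r) (inj₂ s) eq =
  inj₂ (inj r s (trans eq (+-comm (f c) (f d))))
symmetricWeight-injective {f = f} inj {a} {b} (inj₂ r) (inj₁ s) eq =
  inj₂ (swap (inj r s (trans (+-comm (f b) (f a)) eq)))
symmetricWeight-injective {f = f} inj {a} {b} {c} {d} (inj₂ r) (inj₂ s) eq =
  inj₁ (swap (inj r s (trans (+-comm (f b) (f a)) (trans eq (+-comm (f c) (f d))))))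

data TriangleStarArc : ℕ → ℕ → Set where
  spoke : ∀ {b} → 1 ≤ b → TriangleStarArc 0 b
  rim   : TriangleStarArc 1 2

CSArc3⇒TriangleStarArc : ∀ {a b} → CSArc 3 a b → TriangleStarArc a b
CSArc3⇒TriangleStarArc (path {0} _)    = spoke (s≤s z≤n)
CSArc3⇒TriangleStarArc (path {1} _)    = rim
CSArc3⇒TriangleStarArc (path {suc (suc _)} (s≤s (s≤s (s≤s ()))))
CSArc3⇒TriangleStarArc (close refl)    = spoke (s≤s z≤n)
CSArc3⇒TriangleStarArc (leaf (s≤s _))  = spoke (s≤s z≤n)

hubLabel : ℕ → ℕ → ℕ
hubLabel h zero    = h
hubLabel h (suc v) = suc v

hubLabel-arcWeightInjective : ∀ h → 3 ≤ h → ArcWeightInjective TriangleStarArc (hubLabel h)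
hubLabel-arcWeightInjective h h≥3 (spoke {suc _} _) (spoke {suc _} _) eq =
  refl , +-cancelˡ-≡ h _ _ eq
hubLabel-arcWeightInjective h h≥3 (spoke {suc _} 1≤b) rim eq =
  ⊥-elim (<⇒≢ (+-mono-≤ h≥3 1≤b) (sym eq))
hubLabel-arcWeightInjective h h≥3 rim (spoke {suc _} 1≤d) eq =
  ⊥-elim (<⇒≢ (+-mono-≤ h≥3 1≤d) eq)
hubLabel-arcWeightInjective h h≥3 rim rim eq = refl , refl

module _ (m : ℕ) where
  hubLabeling : Labeling {3 + suc m} (3 + m)
  hubLabeling = record { φ = λ v → hubLabel (3 + m) (toℕ v) ; range = in-range }
    where
    in-range : ∀ v → 1 ≤ hubLabel (3 + m) (toℕ v) × hubLabel (3 + m) (toℕ v) ≤ 3 + m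
    in-range fzero    = s≤s z≤n , ≤-refl
    in-range (fsuc v) = s≤s z≤n , toℕ<n v

  hubLabeling-irregular : EdgeIrregular (CS 3 (suc m)) (3 + m) hubLabeling
  hubLabeling-irregular u v x y uv xy eq
    with symmetricWeight-injective {f = hubLabel (3 + m)}
           (hubLabel-arcWeightInjective (3 + m) (s≤s (s≤s (s≤s z≤n)))) (arcs uv) (arcs xy) eq
    where
    arcs : ∀ {a b} → CSArc 3 a b ⊎ CSArc 3 b a → TriangleStarArc a b ⊎ TriangleStarArc b a
    arcs = Sum.map CSArc3⇒TriangleStarArc CSArc3⇒TriangleStarArc
  ... | inj₁ (p , q) = inj₁ (toℕ-injective p , toℕ-injective q)
  ... | inj₂ (p , q) = inj₂ (toℕ-injective p , toℕ-injective q)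

  hub-adjacent : ∀ (i : Fin (3 + m)) → CS 3 (suc m) fzero (fsuc i)
  hub-adjacent fzero           = inj₁ (path (s≤s (s≤s z≤n)))
  hub-adjacent (fsuc fzero)    = inj₁ (close refl)
  hub-adjacent (fsuc (fsuc i)) = inj₁ (leaf (s≤s (s≤s (s≤s z≤n))))

theorem3p2 : (n : ℕ) → 4 ≤ n → EdgeIrregularityStrength (CS 3 (n ∸ 3)) (n ∸ 1)
theorem3p2 (suc (suc (suc (suc m)))) (s≤s (s≤s (s≤s (s≤s _)))) =
  (hubLabeling m , hubLabeling-irregular m) ,
  λ k → neighbourCount≤strength (CS 3 (suc m)) fzero fsuc suc-injective (hub-adjacent m)
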